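{- A precubical set $C$ is geometric if and only if its category of elements $\mathrm{El}(C)$ is a poset in which any two elements having a common lower bound have a greatest lower bound (equivalently, for every $x\in\mathrm{El}(C)$ the slice category $x/\mathrm{El}(C)$ is a meet semilattice).
   Context: A precubical set is a presheaf $C$ on the precubical category $\square$, whose objects are the natural numbers and whose morphisms are generated by $\varepsilon^\epsilon_{i,n}:n\to n+1$ ($\epsilon\in\{ -,+\}$, $0\le i\le n$) subject to $\varepsilon^{\epsilon'}_{i,n+1}\varepsilon^\epsilon_{j,n}=\varepsilon^\epsilon_{j+1,n+1}\varepsilon^{\epsilon'}_{i,n}$ for $i\le j$. Elements of $C(n)$ are $n$-cubes; iterated faces of $c\in C(n)$ are the $C(\phi)(c)$ for $\phi:m\to n$. $C$ is geometric if (1) for every $c\in C(n)$ and morphisms $\phi,\psi:m\to n$ in $\square$, $C(\phi)(c)=C(\psi)(c)$ implies $\phi=\psi$, and (2) any two cubes admitting a common iterated face admit a maximal common iterated face. The category of elements $\mathrm{El}(C)$ has objects pairs $(n,c)$ with $c\in C(n)$ and morphisms $(m,c')\to(n,c)$ the $\phi:m\to n$ in $\square$ with $C(\phi)(c)=c'$. -}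

module Defs where

open import Data.Nat using (ℕ; suc)
open import Data.Fin using (Fin; inject₁) renaming (suc to fsuc; _≤_ to _≤F_)
open import Data.Product using (Σ; _×_; _,_; proj₁)
open import Relation.Binary.PropositionalEquality using (_≡_)

data Sign : Set where
  minus plus : Sign

-- Words in the generators: a word  Hom m n  is either the identity, or
-- δ s i φ = ε^s_{i,n} ∘ φ  with  φ : m → n  and  ε^s_{i,n} : n → n+1 (0 ≤ i ≤ n).
data Hom : ℕ → ℕ → Set where
  idH : ∀ {n} → Hom n n
  δ   : ∀ {m n} → Sign → Fin (suc n) → Hom m n → Hom m (suc n)

infixr 9 _∘H_
_∘H_ : ∀ {m n k} → Hom n k → Hom m n → Hom m k
idH ∘H φ = φ
δ s i ψ ∘H φ = δ s i (ψ ∘H φ)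

-- Equality of morphisms in □: the congruence generated by the relations
--   ε^{s'}_{i,n+1} ε^s_{j,n} = ε^s_{j+1,n+1} ε^{s'}_{i,n}   (i ≤ j).
-- (Closure under precomposition is built into `rel` via the arbitrary φ,
--  closure under postcomposition is `δ-cong`.)
infix 4 _≈_
data _≈_ : ∀ {m n} → Hom m n → Hom m n → Set where
  ≈-refl  : ∀ {m n} {φ : Hom m n} → φ ≈ φ
  ≈-sym   : ∀ {m n} {φ ψ : Hom m n} → φ ≈ ψ → ψ ≈ φ
  ≈-trans : ∀ {m n} {φ ψ χ : Hom m n} → φ ≈ ψ → ψ ≈ χ → φ ≈ χ
  δ-cong  : ∀ {m n} (s : Sign) (i : Fin (suc n)) {φ ψ : Hom m n} →
            φ ≈ ψ → δ s i φ ≈ δ s i ψ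
  rel     : ∀ {m n} (s s' : Sign) (i j : Fin (suc n)) → i ≤F j →
            (φ : Hom m n) →
            δ s' (inject₁ i) (δ s j φ) ≈ δ s (fsuc j) (δ s' i φ)

record PrecubicalSet : Set₁ where
  field
    Cell   : ℕ → Set
    act    : ∀ {m n} → Hom m n → Cell n → Cell m
    act-id : ∀ {n} (c : Cell n) → act idH c ≡ c
    act-∘  : ∀ {m n k} (ψ : Hom n k) (φ : Hom m n) (c : Cell k) →
             act (ψ ∘H φ) c ≡ act φ (act ψ c)
    act-≈  : ∀ {m n} {φ ψ : Hom m n} → φ ≈ ψ → (c : Cell n) →
             act φ c ≡ act ψ c

module _ (C : PrecubicalSet) where
  open PrecubicalSet C

  IterFace : ∀ {k n} → Cell k → Cell n → Set
  IterFace {k} {n} d c = Σ (Hom k n) λ φ → act φ c ≡ d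

  CommonFace : ∀ {k n₁ n₂} → Cell k → Cell n₁ → Cell n₂ → Set
  CommonFace d c₁ c₂ = IterFace d c₁ × IterFace d c₂

  HasCommonFace : ∀ {n₁ n₂} → Cell n₁ → Cell n₂ → Set
  HasCommonFace c₁ c₂ = Σ ℕ λ k → Σ (Cell k) λ d → CommonFace d c₁ c₂

  -- a maximal (= greatest) common iterated face
  HasMaximalCommonFace : ∀ {n₁ n₂} → Cell n₁ → Cell n₂ → Set
  HasMaximalCommonFace c₁ c₂ =
    Σ ℕ λ k → Σ (Cell k) λ d → CommonFace d c₁ c₂ ×
      (∀ {k'} (e : Cell k') → CommonFace e c₁ c₂ → IterFace e d)

  IsGeometric : Set
  IsGeometric =
    (∀ {m n} (c : Cell n) (φ ψ : Hom m n) → act φ c ≡ act ψ c → φ ≈ ψ) ×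
    (∀ {n₁ n₂} (c₁ : Cell n₁) (c₂ : Cell n₂) →
       HasCommonFace c₁ c₂ → HasMaximalCommonFace c₁ c₂)

  El : Set
  El = Σ ℕ Cell

  -- morphisms (m , c') ⇒ (n , c): φ : m → n in □ with C(φ)(c) = c';
  -- two such morphisms are equal iff they are equal in □ (i.e. ≈).
  infix 4 _⇒_
  _⇒_ : El → El → Set
  (m , c') ⇒ (n , c) = Σ (Hom m n) λ φ → act φ c ≡ c'

  ElIsPoset : Set
  ElIsPoset =
    (∀ (x y : El) (f g : x ⇒ y) → proj₁ f ≈ proj₁ g) ×
    (∀ (x y : El) → x ⇒ y → y ⇒ x → x ≡ y)

  ElHasGLBs : Set
  ElHasGLBs =
    ∀ (x y : El) → (Σ El λ z → z ⇒ x × z ⇒ y) →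
      Σ El λ w → w ⇒ x × w ⇒ y × (∀ (z : El) → z ⇒ x → z ⇒ y → z ⇒ w)

-- A morphism (m , d) ⇒ (n , c) of El(C) is literally a witness that d is an
-- iterated face of c, so thinness of El(C) is condition (1) and greatest lower
-- bounds in El(C) are greatest common iterated faces, i.e. condition (2).
-- Antisymmetry holds in every El(C): a non-identity word of □ raises dimension.
{-# OPTIONS --safe #-}
module Submission where

open import Defs
open import Data.Nat using (_≤_)
open import Data.Nat.Properties using (≤-refl; ≤-trans; m≤n⇒m≤1+n; 1+n≰n)
open import Data.Product using (_×_; _,_; proj₁)
open import Data.Empty using (⊥-elim)
open import Function.Bundles using (_⇔_; mk⇔; module Equivalence)
open import Relation.Binary.PropositionalEquality using (_≡_; refl; sym; trans; cong)

Hom⇒≤ : ∀ {m n} → Hom m n → m ≤ n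
Hom⇒≤ idH       = ≤-refl
Hom⇒≤ (δ _ _ φ) = m≤n⇒m≤1+n (Hom⇒≤ φ)

module _ (C : PrecubicalSet) where
  open PrecubicalSet C

  ActInjective : Set
  ActInjective = ∀ {m n} (c : Cell n) (φ ψ : Hom m n) → act φ c ≡ act ψ c → φ ≈ ψ

  ElIsThin : Set
  ElIsThin = ∀ (x y : El C) (f g : _⇒_ C x y) → proj₁ f ≈ proj₁ g

  CommonFacesHaveMaximum : Set
  CommonFacesHaveMaximum = ∀ {n₁ n₂} (c₁ : Cell n₁) (c₂ : Cell n₂) →
    HasCommonFace C c₁ c₂ → HasMaximalCommonFace C c₁ c₂

  actInjective⇔ElIsThin : ActInjective ⇔ ElIsThin
  actInjective⇔ElIsThin = mk⇔
    (λ inj (_ , _) (_ , c) (φ , φc≡d) (ψ , ψc≡d) → inj c φ ψ (trans φc≡d (sym ψc≡d)))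
    (λ thin {m} {n} c φ ψ φc≡ψc → thin (m , act φ c) (n , c) (φ , refl) (ψ , sym φc≡ψc))

  commonFacesHaveMaximum⇔ElHasGLBs : CommonFacesHaveMaximum ⇔ ElHasGLBs C
  commonFacesHaveMaximum⇔ElHasGLBs = mk⇔ maximum⇒glb glb⇒maximum
    where
    maximum⇒glb : CommonFacesHaveMaximum → ElHasGLBs C
    maximum⇒glb max (_ , c₁) (_ , c₂) ((k , d) , d≤c₁ , d≤c₂) =
      let (k' , d' , (d'≤c₁ , d'≤c₂) , greatest) = max c₁ c₂ (k , d , d≤c₁ , d≤c₂)
      in (k' , d') , d'≤c₁ , d'≤c₂ , λ (_ , e) e≤c₁ e≤c₂ → greatest e (e≤c₁ , e≤c₂)

    glb⇒maximum : ElHasGLBs C → CommonFacesHaveMaximum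
    glb⇒maximum glb {n₁} {n₂} c₁ c₂ (k , d , d≤c₁ , d≤c₂) =
      let ((k' , d') , d'≤c₁ , d'≤c₂ , greatest) = glb (n₁ , c₁) (n₂ , c₂) ((k , d) , d≤c₁ , d≤c₂)
      in k' , d' , (d'≤c₁ , d'≤c₂) , λ {k''} e (e≤c₁ , e≤c₂) → greatest (k'' , e) e≤c₁ e≤c₂

  El-antisym : ∀ (x y : El C) → _⇒_ C x y → _⇒_ C y x → x ≡ y
  El-antisym (m , d) (.m , c) (idH , c≡d) _ = cong (m ,_) (trans (sym c≡d) (act-id c))
  El-antisym _ _ (δ _ _ φ , _) (ψ , _) = ⊥-elim (1+n≰n (≤-trans (Hom⇒≤ ψ) (Hom⇒≤ φ)))

lemma1p21 : (C : PrecubicalSet) → IsGeometric C ⇔ (ElIsPoset C × ElHasGLBs C)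
lemma1p21 C = mk⇔
  (λ (inj , max) → (to thin⇔ inj , El-antisym C) , to glb⇔ max)
  (λ ((thin , _) , glbs) → from thin⇔ thin , from glb⇔ glbs)
  where
  open Equivalence
  thin⇔ : ActInjective C ⇔ ElIsThin C
  thin⇔ = actInjective⇔ElIsThin C
  glb⇔ : CommonFacesHaveMaximum C ⇔ ElHasGLBs C
  glb⇔ = commonFacesHaveMaximum⇔ElHasGLBs C
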